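{- For every $n \geq 1$, $$\deg(\delta_n) = 2^n,\quad \mathrm{low}(\delta_n) = \frac{2^n}{3} - \frac{(-1)^n}{3} + 1,\quad \deg(\varepsilon_n) = 2^n - n,\quad \mathrm{low}(\varepsilon_n) = \frac{2^n}{3} + \frac{(-1)^n}{6} + \frac12.$$
   Context: The polynomials $\delta_n, \varepsilon_n \in \mathbb{Z}[k]$, $n \geq 1$, are defined by $(\delta_1(k),\varepsilon_1(k)) = (2k^2, k)$ and, for $n \geq 2$, $\delta_n(k) = \delta_{n-1}(k)^2 + \varepsilon_{n-1}(k)^2$, $\varepsilon_n(k) = \delta_{n-1}(k)\varepsilon_{n-1}(k)/k$. For a nonzero polynomial $f$, $\deg(f)$ is its degree and $\mathrm{low}(f)$ is the degree of its lowest-degree term with nonzero coefficient. -}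

module Defs where

open import Data.Nat using (ℕ; zero; suc)
open import Data.Integer using (ℤ; +_; _+_; _*_)
open import Data.List using (List; []; _∷_)
open import Data.Product using (_×_; _,_; proj₁; proj₂)
open import Relation.Binary.PropositionalEquality using (_≡_; _≢_)
open import Data.Nat using (_<_)

-- Polynomials in ℤ[k] as coefficient lists: the i-th entry is the
-- coefficient of k^i (trailing zeros allowed; missing entries are 0).
Poly : Set
Poly = List ℤ

coeff : Poly → ℕ → ℤ
coeff []       _       = + 0
coeff (a ∷ p)  zero    = a
coeff (a ∷ p)  (suc i) = coeff p i

infixl 6 _⊕_
infixl 7 _⊛_ _·_

_⊕_ : Poly → Poly → Poly
[]      ⊕ q       = q
(a ∷ p) ⊕ []      = a ∷ p
(a ∷ p) ⊕ (b ∷ q) = (a + b) ∷ (p ⊕ q)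

_·_ : ℤ → Poly → Poly
c · []      = []
c · (a ∷ p) = (c * a) ∷ (c · p)

_⊛_ : Poly → Poly → Poly
[]      ⊛ q = []
(a ∷ p) ⊛ q = (a · q) ⊕ (+ 0 ∷ (p ⊛ q))

-- division by k: drop the constant coefficient (exact division when the
-- constant term is 0, which is the case where it is used below)
divK : Poly → Poly
divK []      = []
divK (a ∷ p) = p

step : Poly × Poly → Poly × Poly
step (d , e) = (d ⊛ d ⊕ e ⊛ e , divK (d ⊛ e))

base : Poly × Poly
base = (+ 0 ∷ + 0 ∷ + 2 ∷ [] , + 0 ∷ + 1 ∷ [])

-- pair n = (δ_n, ε_n) for n ≥ 1 (value at n = 0 is an unused dummy)
pair : ℕ → Poly × Poly
pair zero          = ([] , [])
pair (suc zero)    = base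
pair (suc (suc n)) = step (pair (suc n))

δ : ℕ → Poly
δ n = proj₁ (pair n)

ε : ℕ → Poly
ε n = proj₂ (pair n)

IsDeg : Poly → ℕ → Set
IsDeg f d = (coeff f d ≢ + 0) × (∀ i → d < i → coeff f i ≡ + 0)

IsLow : Poly → ℕ → Set
IsLow f l = (coeff f l ≢ + 0) × (∀ i → i < l → coeff f i ≡ + 0)

{-# OPTIONS --safe #-}
module Submission where

-- All coefficients of δ_n and ε_n are natural numbers, so no cancellation
-- occurs: deg and low are additive under products and are max and min under
-- sums. This gives deg δ_{n+1} = 2 deg δ_n, deg ε_{n+1} = deg δ_n + deg ε_n - 1,
-- low δ_{n+1} = 2 low ε_n and low ε_{n+1} = low δ_n + low ε_n - 1, whose
-- solutions are the stated closed forms.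

open import Defs
open import Data.Product using (_×_; _,_; Σ; proj₁; proj₂)
open import Function using (_∘_)
open import Relation.Binary.PropositionalEquality
  using (_≡_; _≢_; refl; sym; trans; cong; cong₂; subst; module ≡-Reasoning)

-- A separate module, so that ℕ's operators can be opened unqualified here
-- while the statement below uses ℤ's.
module CoefficientSequences where

  open import Data.Nat
    using (ℕ; zero; suc; _+_; _*_; _∸_; _^_; _≤_; _<_; z≤n; s≤s; z<s)
  open import Data.Nat.Properties
  open import Relation.Nullary using (contradiction)

  Seq : Set
  Seq = ℕ → ℕ

  infixl 6 _⊞_

  _⊞_ : Seq → Seq → Seq
  (F ⊞ G) i = F i + G i

  -- conv F G i = Σ_{j + k = i} F j * G k
  conv : Seq → Seq → Seq
  conv F G zero    = F 0 * G 0
  conv F G (suc i) = F 0 * G (suc i) + conv (F ∘ suc) G i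

  Deg : Seq → ℕ → Set
  Deg F d = 0 < F d × (∀ i → d < i → F i ≡ 0)

  Low : Seq → ℕ → Set
  Low F l = 0 < F l × (∀ i → i < l → F i ≡ 0)

  conv-zeroˡ : ∀ F G → (∀ j → F j ≡ 0) → ∀ i → conv F G i ≡ 0
  conv-zeroˡ F G F≡0 zero    rewrite F≡0 0 = refl
  conv-zeroˡ F G F≡0 (suc i) rewrite F≡0 0 = conv-zeroˡ (F ∘ suc) G (F≡0 ∘ suc) i

  conv-≥ : ∀ F G a b → F a * G b ≤ conv F G (a + b)
  conv-≥ F G zero    zero    = ≤-refl
  conv-≥ F G zero    (suc b) = m≤m+n _ _
  conv-≥ F G (suc a) b       = ≤-trans (conv-≥ (F ∘ suc) G a b) (m≤n+m _ _)

  conv-pos : ∀ F G a b → 0 < F a → 0 < G b → 0 < conv F G (a + b)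
  conv-pos F G a b Fa>0 Gb>0 = <-≤-trans (*-mono-≤ Fa>0 Gb>0) (conv-≥ F G a b)

  conv-vanishes-above : ∀ F G a b →
                        (∀ j → a < j → F j ≡ 0) → (∀ k → b < k → G k ≡ 0) →
                        ∀ i → a + b < i → conv F G i ≡ 0
  conv-vanishes-above F G a b F≡0 G≡0 (suc i) a+b<1+i
    rewrite G≡0 (suc i) (≤-<-trans (m≤n+m b a) a+b<1+i) | *-zeroʳ (F 0) =
      shifted a F≡0 a+b<1+i
    where
    shifted : ∀ a → (∀ j → a < j → F j ≡ 0) → a + b < suc i →
              conv (F ∘ suc) G i ≡ 0
    shifted zero    F≡0 _ = conv-zeroˡ (F ∘ suc) G (λ j → F≡0 (suc j) z<s) i
    shifted (suc a) F≡0 (s≤s a+b<i) =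
      conv-vanishes-above (F ∘ suc) G a b (λ j a<j → F≡0 (suc j) (s≤s a<j)) G≡0 i a+b<i

  conv-vanishes-below : ∀ F G a b →
                        (∀ j → j < a → F j ≡ 0) → (∀ k → k < b → G k ≡ 0) →
                        ∀ i → i < a + b → conv F G i ≡ 0
  conv-vanishes-below F G zero    b F≡0 G≡0 zero    0<b rewrite G≡0 0 0<b = *-zeroʳ (F 0)
  conv-vanishes-below F G (suc a) b F≡0 G≡0 zero    _   rewrite F≡0 0 z<s = refl
  conv-vanishes-below F G zero    b F≡0 G≡0 (suc i) 1+i<b
    rewrite G≡0 (suc i) 1+i<b | *-zeroʳ (F 0) =
    conv-vanishes-below (F ∘ suc) G zero b (λ _ ()) G≡0 i (<-trans (n<1+n i) 1+i<b)
  conv-vanishes-below F G (suc a) b F≡0 G≡0 (suc i) (s≤s i<a+b) rewrite F≡0 0 z<s =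
    conv-vanishes-below (F ∘ suc) G a b (λ j j<a → F≡0 (suc j) (s≤s j<a)) G≡0 i i<a+b

  deg-conv : ∀ {F G a b} → Deg F a → Deg G b → Deg (conv F G) (a + b)
  deg-conv {F} {G} {a} {b} (Fa>0 , F≡0) (Gb>0 , G≡0) =
    conv-pos F G a b Fa>0 Gb>0 , conv-vanishes-above F G a b F≡0 G≡0

  low-conv : ∀ {F G a b} → Low F a → Low G b → Low (conv F G) (a + b)
  low-conv {F} {G} {a} {b} (Fa>0 , F≡0) (Gb>0 , G≡0) =
    conv-pos F G a b Fa>0 Gb>0 , conv-vanishes-below F G a b F≡0 G≡0

  deg-⊞ : ∀ {F G a b} → Deg F a → Deg G b → b ≤ a → Deg (F ⊞ G) a
  deg-⊞ (Fa>0 , F≡0) (_ , G≡0) b≤a =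
      <-≤-trans Fa>0 (m≤m+n _ _)
    , λ i a<i → cong₂ _+_ (F≡0 i a<i) (G≡0 i (≤-<-trans b≤a a<i))

  low-⊞ : ∀ {F G a b} → Low F a → Low G b → b ≤ a → Low (F ⊞ G) b
  low-⊞ (_ , F≡0) (Gb>0 , G≡0) b≤a =
      <-≤-trans Gb>0 (m≤n+m _ _)
    , λ i i<b → cong₂ _+_ (F≡0 i (<-≤-trans i<b b≤a)) (G≡0 i i<b)

  deg-∘suc : ∀ {F d} → Deg F (suc d) → Deg (F ∘ suc) d
  deg-∘suc (Fd>0 , F≡0) = Fd>0 , λ i d<i → F≡0 (suc i) (s≤s d<i)

  low-∘suc : ∀ {F l} → Low F (suc l) → Low (F ∘ suc) l
  low-∘suc (Fl>0 , F≡0) = Fl>0 , λ i i<l → F≡0 (suc i) (s≤s i<l)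

  monomial : ℕ → ℕ → Seq
  monomial c zero    zero    = c
  monomial c zero    (suc i) = 0
  monomial c (suc k) zero    = 0
  monomial c (suc k) (suc i) = monomial c k i

  monomial-diag : ∀ c k → monomial c k k ≡ c
  monomial-diag c zero    = refl
  monomial-diag c (suc k) = monomial-diag c k

  monomial-off : ∀ c k i → i ≢ k → monomial c k i ≡ 0
  monomial-off c zero    zero    0≢0 = contradiction refl 0≢0
  monomial-off c zero    (suc i) _   = refl
  monomial-off c (suc k) zero    _   = refl
  monomial-off c (suc k) (suc i) i≢k = monomial-off c k i (i≢k ∘ cong suc)

  deg-monomial : ∀ {c} k → 0 < c → Deg (monomial c k) k
  deg-monomial {c} k c>0 =
    subst (0 <_) (sym (monomial-diag c k)) c>0 , λ i k<i → monomial-off c k i (>⇒≢ k<i)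

  low-monomial : ∀ {c} k → 0 < c → Low (monomial c k) k
  low-monomial {c} k c>0 =
    subst (0 <_) (sym (monomial-diag c k)) c>0 , λ i i<k → monomial-off c k i (<⇒≢ i<k)

  stepₛ : Seq × Seq → Seq × Seq
  stepₛ (F , G) = (conv F F ⊞ conv G G , conv F G ∘ suc)

  deg-stepₛ : ∀ {F G a b} → Deg F a → Deg G (suc b) → suc b ≤ a →
              Deg (proj₁ (stepₛ (F , G))) (a + a)
              × Deg (proj₂ (stepₛ (F , G))) (a + b)
  deg-stepₛ {a = a} {b} dF dG b<a =
      deg-⊞ (deg-conv dF dF) (deg-conv dG dG) (+-mono-≤ b<a b<a)
    , deg-∘suc (subst (Deg _) (+-suc a b) (deg-conv dF dG))

  low-stepₛ : ∀ {F G a b} → Low F (suc a) → Low G (suc b) → b ≤ a →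
              Low (proj₁ (stepₛ (F , G))) (suc (b + suc b))
              × Low (proj₂ (stepₛ (F , G))) (suc (a + b))
  low-stepₛ {a = a} {b} lF lG b≤a =
      low-⊞ (low-conv lF lF) (low-conv lG lG) (+-mono-≤ (s≤s b≤a) (s≤s b≤a))
    , low-∘suc (subst (Low _) (cong suc (+-suc a b)) (low-conv lF lG))

  -- pairₛ m are the coefficient sequences of pair (suc m)
  pairₛ : ℕ → Seq × Seq
  pairₛ zero    = (monomial 2 2 , monomial 1 1)
  pairₛ (suc m) = stepₛ (pairₛ m)

  Δ E : ℕ → Seq
  Δ m = proj₁ (pairₛ m)
  E m = proj₂ (pairₛ m)

  -- low δ_{m+1} = suc (ℓδ m) and low ε_{m+1} = suc (ℓε m); the shift by one
  -- keeps the recursion free of truncated subtraction.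
  ℓδ ℓε : ℕ → ℕ
  ℓδ zero    = 1
  ℓδ (suc m) = ℓε m + suc (ℓε m)
  ℓε zero    = 0
  ℓε (suc m) = ℓδ m + ℓε m

  ℓε≤ℓδ≤1+ℓε : ∀ m → ℓε m ≤ ℓδ m × ℓδ m ≤ suc (ℓε m)
  ℓε≤ℓδ≤1+ℓε zero = z≤n , s≤s z≤n
  ℓε≤ℓδ≤1+ℓε (suc m) =
      subst (_≤ ℓδ (suc m)) (+-comm (ℓε m) (ℓδ m)) (+-monoʳ-≤ (ℓε m) ℓδ≤1+ℓε)
    , ≤-trans (≤-reflexive (+-suc (ℓε m) (ℓε m))) (s≤s (+-monoˡ-≤ (ℓε m) ℓε≤ℓδ))
    where
    ℓε≤ℓδ : ℓε m ≤ ℓδ m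
    ℓε≤ℓδ = proj₁ (ℓε≤ℓδ≤1+ℓε m)
    ℓδ≤1+ℓε : ℓδ m ≤ suc (ℓε m)
    ℓδ≤1+ℓε = proj₂ (ℓε≤ℓδ≤1+ℓε m)

  low-pairₛ : ∀ m → Low (Δ m) (suc (ℓδ m)) × Low (E m) (suc (ℓε m))
  low-pairₛ zero    = low-monomial 2 z<s , low-monomial 1 z<s
  low-pairₛ (suc m) =
    low-stepₛ (proj₁ (low-pairₛ m)) (proj₂ (low-pairₛ m))
              (proj₁ (ℓε≤ℓδ≤1+ℓε m))

  n<2^n : ∀ n → n < 2 ^ n
  n<2^n zero    = z<s
  n<2^n (suc n) = +-mono-≤ (m^n>0 2 n) (≤-trans (n<2^n n) (m≤m+n _ 0))

  n<m⇒m∸n≡suc[m∸suc[n]] : ∀ {m n} → n < m → m ∸ n ≡ suc (m ∸ suc n)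
  n<m⇒m∸n≡suc[m∸suc[n]] {suc m} (s≤s n≤m) = +-∸-assoc 1 n≤m

  deg-pairₛ : ∀ m → Deg (Δ m) (2 ^ suc m) × Deg (E m) (2 ^ suc m ∸ suc m)
  deg-pairₛ zero    = deg-monomial 2 z<s , deg-monomial 1 z<s
  deg-pairₛ (suc m) =
      subst (Deg (Δ (suc m))) (sym 2^[2+m]≡D+D) (proj₁ degs)
    , subst (Deg (E (suc m))) D+[D∸[2+m]]≡2^[2+m]∸[2+m] (proj₂ degs)
    where
    D : ℕ
    D = 2 ^ suc m
    2^[2+m]≡D+D : 2 ^ suc (suc m) ≡ D + D
    2^[2+m]≡D+D = cong (D +_) (+-identityʳ D)
    degE≡1+D∸[2+m] : D ∸ suc m ≡ suc (D ∸ suc (suc m))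
    degE≡1+D∸[2+m] = n<m⇒m∸n≡suc[m∸suc[n]] (n<2^n (suc m))
    D+[D∸[2+m]]≡2^[2+m]∸[2+m] : D + (D ∸ suc (suc m)) ≡ 2 ^ suc (suc m) ∸ suc (suc m)
    D+[D∸[2+m]]≡2^[2+m]∸[2+m] =
      trans (sym (+-∸-assoc D (n<2^n (suc m)))) (cong (_∸ suc (suc m)) (sym 2^[2+m]≡D+D))
    degs : Deg (Δ (suc m)) (D + D) × Deg (E (suc m)) (D + (D ∸ suc (suc m)))
    degs = deg-stepₛ (proj₁ (deg-pairₛ m))
                     (subst (Deg (E m)) degE≡1+D∸[2+m] (proj₂ (deg-pairₛ m)))
                     (subst (_≤ D) degE≡1+D∸[2+m] (m∸n≤m D (suc m)))

open CoefficientSequences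

open import Data.Nat using (ℕ; zero; suc; _<_; _≥_; _∸_)
open import Data.Integer using (ℤ; +_; _+_; _-_; _*_; -1ℤ; _^_)
import Data.Nat as N
open import Data.Integer.Properties
  using (+-identityʳ; +-identityˡ; *-zeroʳ; +-injective; pos-*)
open import Data.Nat.Properties using (<⇒≢)
open import Data.Integer.Tactic.RingSolver using (solve)
open import Data.List using ([]; _∷_)
open ≡-Reasoning

Coeffs : Poly → Seq → Set
Coeffs p F = ∀ i → coeff p i ≡ + F i

coeff-⊕ : ∀ p q i → coeff (p ⊕ q) i ≡ coeff p i + coeff q i
coeff-⊕ []      q       i       = sym (+-identityˡ _)
coeff-⊕ (a ∷ p) []      i       = sym (+-identityʳ _)
coeff-⊕ (a ∷ p) (b ∷ q) zero    = refl
coeff-⊕ (a ∷ p) (b ∷ q) (suc i) = coeff-⊕ p q i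

coeff-· : ∀ c p i → coeff (c · p) i ≡ c * coeff p i
coeff-· c []      i       = sym (*-zeroʳ c)
coeff-· c (a ∷ p) zero    = refl
coeff-· c (a ∷ p) (suc i) = coeff-· c p i

coeff-∷⊛ : ∀ a p q i →
           coeff ((a ∷ p) ⊛ q) i ≡ a * coeff q i + coeff (+ 0 ∷ p ⊛ q) i
coeff-∷⊛ a p q i = trans (coeff-⊕ (a · q) (+ 0 ∷ p ⊛ q) i) (cong (_+ _) (coeff-· a q i))

coeffs-⊕ : ∀ p q {F G} → Coeffs p F → Coeffs q G → Coeffs (p ⊕ q) (F ⊞ G)
coeffs-⊕ p q cF cG i = trans (coeff-⊕ p q i) (cong₂ _+_ (cF i) (cG i))

coeffs-⊛ : ∀ p q {F G} → Coeffs p F → Coeffs q G → Coeffs (p ⊛ q) (conv F G)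
coeffs-⊛ [] q {F} {G} cF cG i =
  cong +_ (sym (conv-zeroˡ F G (λ j → +-injective (sym (cF j))) i))
coeffs-⊛ (a ∷ p) q {F} {G} cF cG zero = begin
  coeff ((a ∷ p) ⊛ q) 0  ≡⟨ coeff-∷⊛ a p q 0 ⟩
  a * coeff q 0 + + 0    ≡⟨ +-identityʳ _ ⟩
  a * coeff q 0          ≡⟨ cong₂ _*_ (cF 0) (cG 0) ⟩
  + F 0 * + G 0          ≡⟨ sym (pos-* (F 0) (G 0)) ⟩
  + conv F G 0           ∎
coeffs-⊛ (a ∷ p) q {F} {G} cF cG (suc i) = begin
  coeff ((a ∷ p) ⊛ q) (suc i)
    ≡⟨ coeff-∷⊛ a p q (suc i) ⟩
  a * coeff q (suc i) + coeff (p ⊛ q) i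
    ≡⟨ cong₂ _+_ (cong₂ _*_ (cF 0) (cG (suc i))) (coeffs-⊛ p q (cF ∘ suc) cG i) ⟩
  + F 0 * + G (suc i) + + conv (F ∘ suc) G i
    ≡⟨ cong (_+ + conv (F ∘ suc) G i) (sym (pos-* (F 0) (G (suc i)))) ⟩
  + conv F G (suc i)
    ∎

coeffs-divK : ∀ p {F} → Coeffs p F → Coeffs (divK p) (F ∘ suc)
coeffs-divK []      cF i = cF (suc i)
coeffs-divK (a ∷ p) cF i = cF (suc i)

coeffs-step : ∀ d e {F G} → Coeffs d F → Coeffs e G →
              Coeffs (proj₁ (step (d , e))) (proj₁ (stepₛ (F , G)))
              × Coeffs (proj₂ (step (d , e))) (proj₂ (stepₛ (F , G)))
coeffs-step d e cF cG =
    coeffs-⊕ (d ⊛ d) (e ⊛ e) (coeffs-⊛ d d cF cF) (coeffs-⊛ e e cG cG)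
  , coeffs-divK (d ⊛ e) (coeffs-⊛ d e cF cG)

coeffs-pair : ∀ m → Coeffs (δ (suc m)) (Δ m) × Coeffs (ε (suc m)) (E m)
coeffs-pair zero = coeffs-δ₁ , coeffs-ε₁
  where
  coeffs-δ₁ : Coeffs (δ 1) (monomial 2 2)
  coeffs-δ₁ 0 = refl
  coeffs-δ₁ 1 = refl
  coeffs-δ₁ 2 = refl
  coeffs-δ₁ (suc (suc (suc i))) = refl
  coeffs-ε₁ : Coeffs (ε 1) (monomial 1 1)
  coeffs-ε₁ 0 = refl
  coeffs-ε₁ 1 = refl
  coeffs-ε₁ (suc (suc i)) = refl
coeffs-pair (suc m) =
  coeffs-step (δ (suc m)) (ε (suc m)) (proj₁ (coeffs-pair m)) (proj₂ (coeffs-pair m))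

coeff≢0 : ∀ p {F i} → Coeffs p F → 0 < F i → coeff p i ≢ + 0
coeff≢0 p {i = i} cF Fi>0 eq = <⇒≢ Fi>0 (sym (+-injective (trans (sym (cF i)) eq)))

isDeg : ∀ p {F d} → Coeffs p F → Deg F d → IsDeg p d
isDeg p cF (Fd>0 , F≡0) = coeff≢0 p cF Fd>0 , λ i d<i → trans (cF i) (cong +_ (F≡0 i d<i))

isLow : ∀ p {F l} → Coeffs p F → Low F l → IsLow p l
isLow p cF (Fl>0 , F≡0) = coeff≢0 p cF Fl>0 , λ i i<l → trans (cF i) (cong +_ (F≡0 i i<l))

-- P = 2^n and s = (-1)^n
closed-forms-step : ∀ P s d e →
  + 3 * (+ 1 + d) ≡ P - s + + 3 → + 6 * (+ 1 + e) ≡ + 2 * P + s + + 3 →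
    + 3 * (+ 1 + (e + (+ 1 + e))) ≡ + 2 * P - -1ℤ * s + + 3
  × + 6 * (+ 1 + (d + e)) ≡ + 2 * (+ 2 * P) + -1ℤ * s + + 3
closed-forms-step P s d e hδ hε =
    (begin
      + 3 * (+ 1 + (e + (+ 1 + e)))  ≡⟨ solve (e ∷ []) ⟩
      + 6 * (+ 1 + e)                ≡⟨ hε ⟩
      + 2 * P + s + + 3              ≡⟨ solve (P ∷ s ∷ []) ⟩
      + 2 * P - -1ℤ * s + + 3        ∎)
  , (begin
      + 6 * (+ 1 + (d + e))
        ≡⟨ solve (d ∷ e ∷ []) ⟩
      + 2 * (+ 3 * (+ 1 + d)) + + 6 * (+ 1 + e) - + 6
        ≡⟨ cong₂ (λ x y → + 2 * x + y - + 6) hδ hε ⟩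
      + 2 * (P - s + + 3) + (+ 2 * P + s + + 3) - + 6
        ≡⟨ solve (P ∷ s ∷ []) ⟩
      + 2 * (+ 2 * P) + -1ℤ * s + + 3
        ∎)

ℓ-closed-form : ∀ m →
    + 3 * + suc (ℓδ m) ≡ + (2 N.^ suc m) - -1ℤ ^ suc m + + 3
  × + 6 * + suc (ℓε m) ≡ + 2 * + (2 N.^ suc m) + -1ℤ ^ suc m + + 3
ℓ-closed-form zero    = refl , refl
ℓ-closed-form (suc m) =
    trans (proj₁ next) (cong (λ x → x - -1ℤ * s + + 3) (sym 2^[2+m]))
  , trans (proj₂ next) (cong (λ x → + 2 * x + -1ℤ * s + + 3) (sym 2^[2+m]))
  where
  P s : ℤ
  P = + (2 N.^ suc m)
  s = -1ℤ ^ suc m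
  2^[2+m] : + (2 N.^ suc (suc m)) ≡ + 2 * P
  2^[2+m] = pos-* 2 (2 N.^ suc m)
  next : + 3 * + suc (ℓδ (suc m)) ≡ + 2 * P - -1ℤ * s + + 3
       × + 6 * + suc (ℓε (suc m)) ≡ + 2 * (+ 2 * P) + -1ℤ * s + + 3
  next = closed-forms-step P s (+ ℓδ m) (+ ℓε m)
                           (proj₁ (ℓ-closed-form m)) (proj₂ (ℓ-closed-form m))

lemma20 : ∀ (n : ℕ) → n ≥ 1 →
    IsDeg (δ n) (2 N.^ n)
    × Σ ℕ (λ l → IsLow (δ n) l × + 3 * + l ≡ + (2 N.^ n) - -1ℤ ^ n + + 3)
    × IsDeg (ε n) (2 N.^ n ∸ n)
    × Σ ℕ (λ l → IsLow (ε n) l × + 6 * + l ≡ + 2 * + (2 N.^ n) + -1ℤ ^ n + + 3)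
lemma20 zero    ()
lemma20 (suc m) _ =
    isDeg (δ (suc m)) cδ (proj₁ (deg-pairₛ m))
  , (suc (ℓδ m) , isLow (δ (suc m)) cδ (proj₁ (low-pairₛ m)) , proj₁ (ℓ-closed-form m))
  , isDeg (ε (suc m)) cε (proj₂ (deg-pairₛ m))
  , (suc (ℓε m) , isLow (ε (suc m)) cε (proj₂ (low-pairₛ m)) , proj₂ (ℓ-closed-form m))
  where
  cδ : Coeffs (δ (suc m)) (Δ m)
  cδ = proj₁ (coeffs-pair m)
  cε : Coeffs (ε (suc m)) (E m)
  cε = proj₂ (coeffs-pair m)
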